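{- Let $G=(V,E)$ be an unweighted graph on $n$ vertices with no vertex of degree $1$, and for $s,t\in V$ let $\mathcal{A}_{s,t}\subseteq 2^V$ denote the set of minimum $s,t$-cuts in $G$. Given a $(1/6,2n)$-friendly cut sparsifier $H$ of $G$ (its partition of $V$ into super-vertices together with its edges, each recorded with its original endpoints in $G$) and the degrees $\deg_G(v)$ of all $v\in V$, one can recover, for each pair $s,t\in V$, at least one cut $S\in\mathcal{A}_{s,t}$ together with its value $\mathrm{cut}_G(S)$.
   Context: Graphs are undirected, unweighted and simple. For $S\subseteq V$, $\mathrm{cut}_G(S)$ is the number of edges with exactly one endpoint in $S$; a minimum $s,t$-cut is a set $S$ with $s\in S\subseteq V\setminus\{t\}$ minimizing $\mathrm{cut}_G(S)$. For a cut $S$ and $v\in V$, let $c_v(S)$ be the number of edges incident to $v$ with exactly one endpoint in $S$; the friendliness ratio of $v$ with respect to $S$ is $1-c_v(S)/\deg(v)$. The cut $S$ is $\alpha$-friendly if every $v\in V$ has friendliness ratio at least $\alpha$. A contraction of $G$ is obtained from a partition of $V$ into parts (super-vertices) by contracting each part into a single vertex, keeping parallel edges and discarding self-loops; its edges are the edges of $G$ whose endpoints lie in different parts. An $(\alpha,w)$-friendly cut sparsifier of $G$ is a contraction $H$ of $G$ such that every $\alpha$-friendly cut $S\subseteq V$ with $\mathrm{cut}_G(S)\le w$ satisfies $\mathrm{cut}_H(S)=\mathrm{cut}_G(S)$, i.e., no super-vertex has vertices on both sides of $S$ (contracted pairs are viewed as joined by infinite-capacity edges). -}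

module Defs where

open import Data.Nat using (ℕ; zero; suc; _+_; _*_; _≤_)
open import Data.Bool using (Bool; true; false; _∧_; not; _xor_; if_then_else_)
open import Data.Fin using (Fin; zero; suc; _≟_)
open import Data.Product using (_×_; Σ)
open import Relation.Binary.PropositionalEquality using (_≡_; _≢_)
open import Relation.Nullary.Decidable using (⌊_⌋)

VSet : ℕ → Set
VSet n = Fin n → Bool

count : ∀ {n} → (Fin n → Bool) → ℕ
count {zero}  f = 0
count {suc n} f = (if f zero then 1 else 0) + count (λ i → f (suc i))

sumFin : ∀ {n} → (Fin n → ℕ) → ℕ
sumFin {zero}  f = 0
sumFin {suc n} f = f zero + sumFin (λ i → f (suc i))

record Graph (n : ℕ) : Set where
  field
    adj   : Fin n → Fin n → Bool
    sym   : ∀ u v → adj u v ≡ adj v u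
    loopless : ∀ v → adj v v ≡ false
open Graph public

deg : ∀ {n} → Graph n → Fin n → ℕ
deg G v = count (λ u → adj G v u)

-- cut_G(S): number of edges with exactly one endpoint in S
-- (each such edge {u,v} is counted once, as the ordered pair with u ∈ S, v ∉ S).
cut : ∀ {n} → Graph n → VSet n → ℕ
cut G S = sumFin (λ u → count (λ v → S u ∧ not (S v) ∧ adj G u v))

cutAt : ∀ {n} → Graph n → VSet n → Fin n → ℕ
cutAt G S v = count (λ u → adj G v u ∧ (S u xor S v))

-- S is (a/b)-friendly: every v has 1 - c_v(S)/deg(v) ≥ a/b, i.e. b·c_v + a·deg v ≤ b·deg v.
-- (For isolated vertices the ratio 0/0 is read as 1, i.e. they are friendly.)
Friendly : ∀ {n} → Graph n → (a b : ℕ) → VSet n → Set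
Friendly G a b S = ∀ v → b * cutAt G S v + a * deg G v ≤ b * deg G v

IsMinCut : ∀ {n : ℕ} → Graph n → Fin n → Fin n → VSet n → Set
IsMinCut {n} G s t S =
  S s ≡ true × S t ≡ false ×
  (∀ (T : VSet n) → T s ≡ true → T t ≡ false → cut G S ≤ cut G T)

-- A contraction is given by a partition of V = Fin n into parts, described by a
-- labelling p : Fin n → Fin n (u, v in the same super-vertex iff p u ≡ p v).
contractEdges : ∀ {n} → Graph n → (Fin n → Fin n) → Fin n → Fin n → Bool
contractEdges G p u v = adj G u v ∧ not ⌊ p u ≟ p v ⌋

NotSplit : ∀ {n} → (Fin n → Fin n) → VSet n → Set
NotSplit p S = ∀ u v → p u ≡ p v → S u ≡ S v

IsFriendlySparsifier : ∀ {n} → Graph n → (a b w : ℕ) → (Fin n → Fin n) → Set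
IsFriendlySparsifier {n} G a b w p =
  ∀ (S : VSet n) → Friendly G a b S → cut G S ≤ w → NotSplit p S

NoDegreeOne : ∀ {n} → Graph n → Set
NoDegreeOne G = ∀ v → deg G v ≢ 1

-- A recovery procedure: from the partition, the sparsifier's edges (with original
-- endpoints) and the degree sequence, output for each s, t a cut and a value.
Decoder : Set
Decoder = (n : ℕ) → (Fin n → Fin n) → (Fin n → Fin n → Bool) → (Fin n → ℕ)
        → Fin n → Fin n → VSet n × ℕ

module Submission where

-- The decoder tries every labelling L of the super-vertices and evaluates the s,t-cut
-- pin s t (L ∘ p), which follows L except that s is put inside and t outside. Its value is
-- computable from the sparsifier: the contracted edges are given, and an edge inside a
-- super-vertex can cross this cut only at s or t, where it is counted by deg minus the
-- contracted degree. It remains to see that some minimum s,t-cut has this form.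
--
-- Among all X for which pin s t X is a minimum s,t-cut, take one minimising cut G X. Toggling
-- s or t, or a vertex whose toggle keeps pin s t X minimum, stays in this family and so cannot
-- decrease cut G X; this gives c_v ≤ deg v / 2. Toggling any other vertex v strictly increases
-- the minimum cut, so c_v ≤ (deg v - 1) / 2 in pin s t X, and hence c_v ≤ (deg v + 1) / 2 in X,
-- as only one of s, t can add to c_v. Without vertices of degree 1 both bounds make X
-- 1/6-friendly, and cut G X ≤ deg s ≤ n; so the sparsifier does not split X, and pin s t X is
-- pin s t (L ∘ p) for the labelling L of the parts by X.

open import Data.Bool using (Bool; true; false; _∧_; not; _xor_; if_then_else_; T?)
open import Data.Bool.Properties using (T-≡; ∧-zeroʳ)
open import Data.Fin using (Fin; zero; suc; _≟_)
open import Data.Fin.Properties using (suc-injective; any?)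
open import Data.List using ([_])
import Data.List.Extrema.Nat as Extrema
import Data.List.Relation.Unary.All as All
open import Data.Nat using (ℕ; zero; suc; _+_; _*_; _∸_; _≤_; _<_; _≤ᵇ_; _≤?_; z≤n; s≤s)
open import Data.Nat.Properties
  using ( +-0-commutativeMonoid; ≤-refl; ≤-reflexive; ≤-trans; ≤-<-trans; ≰⇒>; n≮n; n≤1+n
        ; m≤n⇒m≤1+n; m≤m+n; m≤n+m; ≤ᵇ⇒≤; ≤⇒≤ᵇ; +-comm; +-suc; +-identityʳ; m+n∸m≡n
        ; +-mono-≤; +-monoˡ-≤; +-monoˡ-<; +-cancelˡ-≤; +-cancelˡ-<; *-monoʳ-≤; *-monoˡ-≤
        ; module ≤-Reasoning )
open import Data.Nat.Tactic.RingSolver using (solve-∀)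
open import Data.Product using (Σ; Σ-syntax; _×_; _,_; proj₁; proj₂)
open import Data.Sum using (_⊎_; inj₁; inj₂)
open import Data.Vec.Functional using (_∷_; head; tail)
open import Defs renaming (sym to adj-sym)
open import Function using (_∘_; Equivalence)
open import Relation.Binary.PropositionalEquality
  using ( _≡_; _≢_; _≗_; refl; sym; ≢-sym; trans; cong; cong₂; subst
        ; ≡-≟-identity; ≢-≟-identity; module ≡-Reasoning )
open import Relation.Nullary using (yes; no; contradiction)
open import Relation.Nullary.Decidable using (⌊_⌋; _×-dec_)

open import Algebra.Properties.CommutativeMonoid.Sum +-0-commutativeMonoid
  using (sum; sum-syntax; sum-cong-≗; ∑-distrib-+; ∑-comm; sum-replicate-zero)

⟦_⟧ : Bool → ℕ
⟦ b ⟧ = if b then 1 else 0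

⟦⟧≤1 : ∀ b → ⟦ b ⟧ ≤ 1
⟦⟧≤1 true  = ≤-refl
⟦⟧≤1 false = z≤n

⟦∧⟧≤⟦∧true⟧ : ∀ a b → ⟦ a ∧ b ⟧ ≤ ⟦ a ∧ true ⟧
⟦∧⟧≤⟦∧true⟧ true  b = ⟦⟧≤1 b
⟦∧⟧≤⟦∧true⟧ false b = z≤n

⟦⟧-split : ∀ a b → ⟦ a ⟧ ≡ ⟦ a ∧ not b ⟧ + ⟦ a ∧ b ⟧
⟦⟧-split false b     = refl
⟦⟧-split true  false = refl
⟦⟧-split true  true  = refl

⟦∧∧⟧-split : ∀ a b c d → ⟦ a ∧ b ∧ c ⟧ ≡ ⟦ a ∧ b ∧ (c ∧ not d) ⟧ + ⟦ a ∧ b ∧ (c ∧ d) ⟧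
⟦∧∧⟧-split false b     c d = refl
⟦∧∧⟧-split true  false c d = refl
⟦∧∧⟧-split true  true  c d = ⟦⟧-split c d

⟦∧⟧-cong-guarded : ∀ {a b} c → (c ≡ true → a ≡ b) → ⟦ a ∧ c ⟧ ≡ ⟦ b ∧ c ⟧
⟦∧⟧-cong-guarded false _   = trans (cong ⟦_⟧ (∧-zeroʳ _)) (sym (cong ⟦_⟧ (∧-zeroʳ _)))
⟦∧⟧-cong-guarded true  a≡b = cong (λ x → ⟦ x ∧ true ⟧) (a≡b refl)

⟦⟧-partition : ∀ {a b} c → (c ≡ true → a ≡ b) → ⟦ c ⟧ ≡ ⟦ not a ∧ c ⟧ + ⟦ b ∧ c ⟧
⟦⟧-partition {a} {b} false _ rewrite ∧-zeroʳ (not a) | ∧-zeroʳ b = refl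
⟦⟧-partition {false} true a≡b rewrite sym (a≡b refl) = refl
⟦⟧-partition {true}  true a≡b rewrite sym (a≡b refl) = refl

⟦∧not∧⟧≡0 : ∀ {a b} c → (c ≡ true → a ≡ true → b ≡ true) → ⟦ a ∧ not b ∧ c ⟧ ≡ 0
⟦∧not∧⟧≡0 {false}         c _ = refl
⟦∧not∧⟧≡0 {true}  {true}  c _ = refl
⟦∧not∧⟧≡0 {true}  {false} false _ = refl
⟦∧not∧⟧≡0 {true}  {false} true  h with h refl refl
... | ()

⌊≟⌋-refl : ∀ {n} (a : Fin n) → ⌊ a ≟ a ⌋ ≡ true
⌊≟⌋-refl a = cong ⌊_⌋ (≡-≟-identity _≟_ refl)

⌊≟⌋-≢ : ∀ {n} {a b : Fin n} → a ≢ b → ⌊ a ≟ b ⌋ ≡ false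
⌊≟⌋-≢ a≢b = cong ⌊_⌋ (≢-≟-identity _≟_ a≢b)

⌊≟⌋-sym : ∀ {n} (a b : Fin n) → ⌊ a ≟ b ⌋ ≡ ⌊ b ≟ a ⌋
⌊≟⌋-sym a b with a ≟ b
... | yes refl = sym (⌊≟⌋-refl a)
... | no a≢b   = sym (⌊≟⌋-≢ (≢-sym a≢b))

count≡∑ : ∀ {n} (f : Fin n → Bool) → count f ≡ ∑[ i < n ] ⟦ f i ⟧
count≡∑ {zero}  f = refl
count≡∑ {suc n} f = cong (⟦ f zero ⟧ +_) (count≡∑ (f ∘ suc))

sumFin≡sum : ∀ {n} (f : Fin n → ℕ) → sumFin f ≡ sum f
sumFin≡sum {zero}  f = refl
sumFin≡sum {suc n} f = cong (f zero +_) (sumFin≡sum (f ∘ suc))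

count≤n : ∀ {n} (f : Fin n → Bool) → count f ≤ n
count≤n {zero}  f = z≤n
count≤n {suc n} f with f zero
... | true  = s≤s (count≤n (f ∘ suc))
... | false = m≤n⇒m≤1+n (count≤n (f ∘ suc))

sum-mono-≤ : ∀ {n} {f g : Fin n → ℕ} → (∀ i → f i ≤ g i) → sum f ≤ sum g
sum-mono-≤ {zero}  f≤g = z≤n
sum-mono-≤ {suc n} f≤g = +-mono-≤ (f≤g zero) (sum-mono-≤ (f≤g ∘ suc))

sum-zero : ∀ {n} {f : Fin n → ℕ} → (∀ i → f i ≡ 0) → sum f ≡ 0
sum-zero {n} f≡0 = trans (sum-cong-≗ f≡0) (sum-replicate-zero n)

sum-point : ∀ {n} {f : Fin n → ℕ} (a : Fin n) → (∀ i → i ≢ a → f i ≡ 0) → sum f ≡ f a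
sum-point {suc n} {f} zero    f≡0 =
  trans (cong (f zero +_) (sum-zero (λ i → f≡0 (suc i) λ ()))) (+-identityʳ (f zero))
sum-point {suc n} {f} (suc a) f≡0 =
  trans (cong (_+ sum (f ∘ suc)) (f≡0 zero λ ())) (sum-point a (λ i i≢a → f≡0 (suc i) (i≢a ∘ suc-injective)))

∑-at : ∀ {n} (a : Fin n) (b : Bool) → ∑[ i < n ] ⟦ ⌊ i ≟ a ⌋ ∧ b ⟧ ≡ ⟦ b ⟧
∑-at a b = trans (sum-point a (λ i i≢a → cong (λ c → ⟦ c ∧ b ⟧) (⌊≟⌋-≢ i≢a)))
                 (cong (λ c → ⟦ c ∧ b ⟧) (⌊≟⌋-refl a))

∑-guard : ∀ {n} (b : Bool) (f : Fin n → Bool) →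
          ∑[ i < n ] ⟦ b ∧ f i ⟧ ≡ (if b then ∑[ i < n ] ⟦ f i ⟧ else 0)
∑-guard     true  f = refl
∑-guard {n} false f = sum-zero {n} (λ _ → refl)

∑-split : ∀ {n} (f g : Fin n → Bool) →
          ∑[ i < n ] ⟦ f i ⟧ ≡ ∑[ i < n ] ⟦ f i ∧ not (g i) ⟧ + ∑[ i < n ] ⟦ f i ∧ g i ⟧
∑-split {n} f g = trans (sum-cong-≗ (λ i → ⟦⟧-split (f i) (g i))) (∑-distrib-+ {n} _ _)

∑∑-distrib-+ : ∀ {n} (f g : Fin n → Fin n → ℕ) →
               ∑[ u < n ] ∑[ w < n ] (f u w + g u w)
               ≡ ∑[ u < n ] ∑[ w < n ] f u w + ∑[ u < n ] ∑[ w < n ] g u w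
∑∑-distrib-+ {n} f g = trans (sum-cong-≗ (λ u → ∑-distrib-+ (f u) (g u))) (∑-distrib-+ {n} _ _)

∑∑-distrib-+₃ : ∀ {n} (f g h : Fin n → Fin n → ℕ) →
                ∑[ u < n ] ∑[ w < n ] (f u w + (g u w + h u w))
                ≡ ∑[ u < n ] ∑[ w < n ] f u w + (∑[ u < n ] ∑[ w < n ] g u w + ∑[ u < n ] ∑[ w < n ] h u w)
∑∑-distrib-+₃ f g h = trans (∑∑-distrib-+ f _) (cong (_ +_) (∑∑-distrib-+ g h))

∑∑-row : ∀ {n} (a : Fin n) (R : Fin n → Bool) →
         ∑[ u < n ] ∑[ w < n ] ⟦ ⌊ u ≟ a ⌋ ∧ R w ⟧ ≡ ∑[ w < n ] ⟦ R w ⟧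
∑∑-row {n} a R = trans (∑-comm {n} {n} _) (sum-cong-≗ (λ w → ∑-at a (R w)))

∑∑-column : ∀ {n} (a : Fin n) (C : Fin n → Bool) →
            ∑[ u < n ] ∑[ w < n ] ⟦ ⌊ w ≟ a ⌋ ∧ C u ⟧ ≡ ∑[ u < n ] ⟦ C u ⟧
∑∑-column a C = sum-cong-≗ (λ u → ∑-at a (C u))

Extensional : ∀ {n} → (VSet n → ℕ) → Set
Extensional {n} f = ∀ {X Y : VSet n} → X ≗ Y → f X ≡ f Y

argmin : ∀ {n} → (VSet n → ℕ) → VSet n
argminWithHead : ∀ {n} → (VSet (suc n) → ℕ) → Bool → VSet (suc n)

argmin {zero}  f = λ ()
argmin {suc n} f = Extrema.argmin f (argminWithHead f true) [ argminWithHead f false ]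

argminWithHead f b = b ∷ argmin (f ∘ (b ∷_))

argmin-minimal : ∀ {n} (f : VSet n → ℕ) → Extensional f → ∀ Y → f (argmin f) ≤ f Y
argmin-minimal {zero}  f f-ext Y = ≤-reflexive (f-ext (λ ()))
argmin-minimal {suc n} f f-ext Y = begin
  f (argmin f)                     ≤⟨ argmin≤argminWithHead (head Y) ⟩
  f (argminWithHead f (head Y))    ≤⟨ argmin-minimal (f ∘ (head Y ∷_)) (f-ext ∘ ∷-cong) (tail Y) ⟩
  f (head Y ∷ tail Y)              ≡⟨ f-ext head∷tail ⟩
  f Y                              ∎
  where
  open ≤-Reasoning
  argmin≤argminWithHead : ∀ b → f (argmin f) ≤ f (argminWithHead f b)
  argmin≤argminWithHead true  = Extrema.f[argmin]≤f[⊤] {f = f} _ [ argminWithHead f false ]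
  argmin≤argminWithHead false = All.head (Extrema.f[argmin]≤f[xs] {f = f} (argminWithHead f true) [ _ ])
  ∷-cong : ∀ {b} {X Z : VSet n} → X ≗ Z → (b ∷ X) ≗ (b ∷ Z)
  ∷-cong X≗Z zero    = refl
  ∷-cong X≗Z (suc i) = X≗Z i
  head∷tail : (head Y ∷ tail Y) ≗ Y
  head∷tail zero    = refl
  head∷tail (suc i) = refl

argmin-within : ∀ {n} (f g : VSet n → ℕ) → Extensional f → Extensional g →
                ∀ {b} (X₀ : VSet n) → g X₀ ≤ b →
                Σ[ X ∈ VSet n ] (g X ≤ b × (∀ Y → g Y ≤ b → f X ≤ f Y))
argmin-within {n} f g f-ext g-ext {b} X₀ gX₀≤b = X , gX≤b , X-minimal
  where
  penalised : VSet n → ℕ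
  penalised Y = if g Y ≤ᵇ b then f Y else suc (f X₀)

  penalised-ext : Extensional penalised
  penalised-ext Y≗Z = cong₂ (λ c x → if c then x else suc (f X₀)) (cong (_≤ᵇ b) (g-ext Y≗Z)) (f-ext Y≗Z)

  penalised-within : ∀ Y → g Y ≤ b → penalised Y ≡ f Y
  penalised-within Y gY≤b with g Y ≤ᵇ b | ≤⇒≤ᵇ gY≤b
  ... | true | _ = refl

  penalised-outside : ∀ Y → (g Y ≤ᵇ b) ≡ false → penalised Y ≡ suc (f X₀)
  penalised-outside Y eq rewrite eq = refl

  X : VSet n
  X = argmin penalised

  penalised-X≤ : ∀ Y → g Y ≤ b → penalised X ≤ f Y
  penalised-X≤ Y gY≤b = ≤-trans (argmin-minimal penalised penalised-ext Y) (≤-reflexive (penalised-within Y gY≤b))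

  gX≤b : g X ≤ b
  gX≤b with g X ≤ᵇ b in eq
  ... | true  = ≤ᵇ⇒≤ (g X) b (Equivalence.from T-≡ eq)
  ... | false = contradiction (subst (_≤ f X₀) (penalised-outside X eq) (penalised-X≤ X₀ gX₀≤b)) (n≮n (f X₀))

  X-minimal : ∀ Y → g Y ≤ b → f X ≤ f Y
  X-minimal Y gY≤b = subst (_≤ f Y) (penalised-within X gX≤b) (penalised-X≤ Y gY≤b)

-- Cuts and toggling

cut≡∑∑ : ∀ {n} (G : Graph n) (S : VSet n) →
         cut G S ≡ ∑[ u < n ] ∑[ w < n ] ⟦ S u ∧ not (S w) ∧ adj G u w ⟧
cut≡∑∑ {n} G S = trans (sumFin≡sum (λ u → count (crossing u))) (sum-cong-≗ (λ u → count≡∑ (crossing u)))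
  where
  crossing : Fin n → Fin n → Bool
  crossing u w = S u ∧ not (S w) ∧ adj G u w

cut-cong : ∀ {n} (G : Graph n) {X Y : VSet n} → X ≗ Y → cut G X ≡ cut G Y
cut-cong G {X} {Y} X≗Y = begin
  cut G X                                                  ≡⟨ cut≡∑∑ G X ⟩
  ∑[ u < _ ] ∑[ w < _ ] ⟦ X u ∧ not (X w) ∧ adj G u w ⟧    ≡⟨ sum-cong-≗ (λ u → sum-cong-≗ (λ w →
                                                                cong₂ (λ a b → ⟦ a ∧ not b ∧ adj G u w ⟧) (X≗Y u) (X≗Y w))) ⟩
  ∑[ u < _ ] ∑[ w < _ ] ⟦ Y u ∧ not (Y w) ∧ adj G u w ⟧    ≡⟨ cut≡∑∑ G Y ⟨
  cut G Y                                                  ∎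
  where open ≡-Reasoning

∅ : ∀ {n} → VSet n
∅ _ = false

cut-∅ : ∀ {n} (G : Graph n) → cut G ∅ ≡ 0
cut-∅ {n} G = trans (cut≡∑∑ G ∅) (sum-zero {n} (λ u → sum-zero {n} (λ w → refl)))

toggle : ∀ {n} → VSet n → Fin n → VSet n
toggle X v u = if ⌊ u ≟ v ⌋ then not (X u) else X u

toggle-at : ∀ {n} (X : VSet n) v → toggle X v v ≡ not (X v)
toggle-at X v rewrite ⌊≟⌋-refl v = refl

toggle-other : ∀ {n} (X : VSet n) {u v : Fin n} → u ≢ v → toggle X v u ≡ X u
toggle-other X u≢v rewrite ⌊≟⌋-≢ u≢v = refl

module _ {n} (G : Graph n) (X : VSet n) (v : Fin n) where

  private
    Y : VSet n
    Y = toggle X v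

    -- Summed over u and w, the extra terms give 2 c_v(X) on the left and deg v on the right.
    cut-toggle-pointwise : ∀ u w →
        ⟦ Y u ∧ not (Y w) ∧ adj G u w ⟧
          + (⟦ ⌊ u ≟ v ⌋ ∧ (adj G v w ∧ (X w xor X v)) ⟧ + ⟦ ⌊ w ≟ v ⌋ ∧ (adj G v u ∧ (X u xor X v)) ⟧)
      ≡ ⟦ X u ∧ not (X w) ∧ adj G u w ⟧
          + (⟦ ⌊ u ≟ v ⌋ ∧ (adj G v w ∧ not (X v)) ⟧ + ⟦ ⌊ w ≟ v ⌋ ∧ (adj G v u ∧ X v) ⟧)
    cut-toggle-pointwise u w with u ≟ v | w ≟ v
    ... | yes refl | yes refl rewrite loopless G u with X u
    ...   | true  = refl
    ...   | false = refl
    cut-toggle-pointwise u w | yes refl | no _ with X u | X w | adj G u w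
    ...   | true  | true  | true  = refl
    ...   | true  | true  | false = refl
    ...   | true  | false | true  = refl
    ...   | true  | false | false = refl
    ...   | false | true  | true  = refl
    ...   | false | true  | false = refl
    ...   | false | false | true  = refl
    ...   | false | false | false = refl
    cut-toggle-pointwise u w | no _ | yes refl rewrite adj-sym G u w with X u | X w | adj G w u
    ...   | true  | true  | true  = refl
    ...   | true  | true  | false = refl
    ...   | true  | false | true  = refl
    ...   | true  | false | false = refl
    ...   | false | true  | true  = refl
    ...   | false | true  | false = refl
    ...   | false | false | true  = refl
    ...   | false | false | false = refl
    cut-toggle-pointwise u w | no _ | no _ = refl

  cut-toggle : cut G (toggle X v) + (cutAt G X v + cutAt G X v) ≡ cut G X + deg G v
  cut-toggle = begin
    cut G Y + (cutAt G X v + cutAt G X v)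
      ≡⟨ cong₂ _+_ (cut≡∑∑ G Y) (cong₂ _+_ (trans (count≡∑ {n} _) (sym (∑∑-row v crossingAt)))
                                            (trans (count≡∑ {n} _) (sym (∑∑-column v crossingAt)))) ⟩
    ∑[ u < n ] ∑[ w < n ] ⟦ Y u ∧ not (Y w) ∧ adj G u w ⟧
      + (∑[ u < n ] ∑[ w < n ] ⟦ ⌊ u ≟ v ⌋ ∧ crossingAt w ⟧ + ∑[ u < n ] ∑[ w < n ] ⟦ ⌊ w ≟ v ⌋ ∧ crossingAt u ⟧)
      ≡⟨ ∑∑-distrib-+₃ {n} _ _ _ ⟨
    ∑[ u < n ] ∑[ w < n ] (⟦ Y u ∧ not (Y w) ∧ adj G u w ⟧
      + (⟦ ⌊ u ≟ v ⌋ ∧ crossingAt w ⟧ + ⟦ ⌊ w ≟ v ⌋ ∧ crossingAt u ⟧))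
      ≡⟨ sum-cong-≗ (λ u → sum-cong-≗ (cut-toggle-pointwise u)) ⟩
    ∑[ u < n ] ∑[ w < n ] (⟦ X u ∧ not (X w) ∧ adj G u w ⟧
      + (⟦ ⌊ u ≟ v ⌋ ∧ (adj G v w ∧ not (X v)) ⟧ + ⟦ ⌊ w ≟ v ⌋ ∧ (adj G v u ∧ X v) ⟧))
      ≡⟨ ∑∑-distrib-+₃ {n} _ _ _ ⟩
    ∑[ u < n ] ∑[ w < n ] ⟦ X u ∧ not (X w) ∧ adj G u w ⟧
      + (∑[ u < n ] ∑[ w < n ] ⟦ ⌊ u ≟ v ⌋ ∧ (adj G v w ∧ not (X v)) ⟧
         + ∑[ u < n ] ∑[ w < n ] ⟦ ⌊ w ≟ v ⌋ ∧ (adj G v u ∧ X v) ⟧)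
      ≡⟨ cong₂ _+_ (sym (cut≡∑∑ G X)) (cong₂ _+_ (∑∑-row {n} v _) (∑∑-column {n} v _)) ⟩
    cut G X + (∑[ w < n ] ⟦ adj G v w ∧ not (X v) ⟧ + ∑[ u < n ] ⟦ adj G v u ∧ X v ⟧)
      ≡⟨ cong (cut G X +_) (trans (count≡∑ (adj G v)) (∑-split (adj G v) (λ _ → X v))) ⟨
    cut G X + deg G v
      ∎
    where
    open ≡-Reasoning
    crossingAt : Fin n → Bool
    crossingAt u = adj G v u ∧ (X u xor X v)

module _ {n} (G : Graph n) {X : VSet n} {v : Fin n} where

  cut≤cut∘toggle⇒cutAt+cutAt≤deg : cut G X ≤ cut G (toggle X v) → cutAt G X v + cutAt G X v ≤ deg G v
  cut≤cut∘toggle⇒cutAt+cutAt≤deg X≤toggled = +-cancelˡ-≤ (cut G X) _ _ (begin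
    cut G X + (cutAt G X v + cutAt G X v)              ≤⟨ +-monoˡ-≤ _ X≤toggled ⟩
    cut G (toggle X v) + (cutAt G X v + cutAt G X v)   ≡⟨ cut-toggle G X v ⟩
    cut G X + deg G v                                  ∎)
    where open ≤-Reasoning

  cut<cut∘toggle⇒cutAt+cutAt<deg : cut G X < cut G (toggle X v) → cutAt G X v + cutAt G X v < deg G v
  cut<cut∘toggle⇒cutAt+cutAt<deg X<toggled = +-cancelˡ-< (cut G X) _ _ (begin-strict
    cut G X + (cutAt G X v + cutAt G X v)              <⟨ +-monoˡ-< _ X<toggled ⟩
    cut G (toggle X v) + (cutAt G X v + cutAt G X v)   ≡⟨ cut-toggle G X v ⟩
    cut G X + deg G v                                  ∎)
    where open ≤-Reasoning

  cut∘toggle≤cut+deg : cut G (toggle X v) ≤ cut G X + deg G v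
  cut∘toggle≤cut+deg = ≤-trans (m≤m+n _ _) (≤-reflexive (cut-toggle G X v))

pin : ∀ {n} → Fin n → Fin n → VSet n → VSet n
pin s t X u = if ⌊ u ≟ s ⌋ then true else if ⌊ u ≟ t ⌋ then false else X u

module _ {n} {s t : Fin n} where

  pin-s : ∀ X → pin s t X s ≡ true
  pin-s X rewrite ⌊≟⌋-refl s = refl

  pin-t : s ≢ t → ∀ X → pin s t X t ≡ false
  pin-t s≢t X rewrite ⌊≟⌋-≢ (≢-sym s≢t) | ⌊≟⌋-refl t = refl

  pin-other : ∀ X {u} → u ≢ s → u ≢ t → pin s t X u ≡ X u
  pin-other X u≢s u≢t rewrite ⌊≟⌋-≢ u≢s | ⌊≟⌋-≢ u≢t = refl

  pin-cong : ∀ {X Y} → (∀ u → u ≢ s → u ≢ t → X u ≡ Y u) → pin s t X ≗ pin s t Y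
  pin-cong X≡Y u with u ≟ s | u ≟ t
  ... | yes _   | _       = refl
  ... | no _    | yes _   = refl
  ... | no u≢s  | no u≢t  = X≡Y u u≢s u≢t

  pin-idem : ∀ X → pin s t (pin s t X) ≗ pin s t X
  pin-idem X = pin-cong (λ u → pin-other X)

  pin-fixes-stCut : ∀ {T} → T s ≡ true → T t ≡ false → pin s t T ≗ T
  pin-fixes-stCut Ts Tt u with u ≟ s | u ≟ t
  ... | yes refl | _        = sym Ts
  ... | no _     | yes refl = sym Tt
  ... | no _     | no _     = refl

  pin∘toggle-pinned : ∀ X {v} → v ≡ s ⊎ v ≡ t → pin s t (toggle X v) ≗ pin s t X
  pin∘toggle-pinned X (inj₁ refl) = pin-cong (λ u u≢s _ → toggle-other X u≢s)
  pin∘toggle-pinned X (inj₂ refl) = pin-cong (λ u _ u≢t → toggle-other X u≢t)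

  pin∘toggle : ∀ X {v} → v ≢ s → v ≢ t → pin s t (toggle X v) ≗ toggle (pin s t X) v
  pin∘toggle X v≢s v≢t u with u ≟ s | u ≟ t
  ... | yes refl | _        rewrite ⌊≟⌋-≢ (v≢s ∘ sym) = refl
  ... | no _     | yes refl rewrite ⌊≟⌋-≢ (v≢t ∘ sym) = refl
  ... | no _     | no _     = refl

cutAt≤suc-cutAt∘pin : ∀ {n} (G : Graph n) {s t} (X : VSet n) {v} → v ≢ s → v ≢ t →
                      cutAt G X v ≤ suc (cutAt G (pin s t X) v)
cutAt≤suc-cutAt∘pin {n} G {s} {t} X {v} v≢s v≢t = begin
  cutAt G X v
    ≡⟨ count≡∑ (λ u → adj G v u ∧ (X u xor X v)) ⟩
  ∑[ u < n ] ⟦ adj G v u ∧ (X u xor X v) ⟧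
    ≤⟨ sum-mono-≤ pointwise ⟩
  ∑[ u < n ] (⟦ adj G v u ∧ (P u xor P v) ⟧ + ⟦ ⌊ u ≟ w₀ ⌋ ∧ true ⟧)
    ≡⟨ ∑-distrib-+ {n} _ _ ⟩
  ∑[ u < n ] ⟦ adj G v u ∧ (P u xor P v) ⟧ + ∑[ u < n ] ⟦ ⌊ u ≟ w₀ ⌋ ∧ true ⟧
    ≡⟨ cong₂ _+_ (sym (count≡∑ (λ u → adj G v u ∧ (P u xor P v)))) (∑-at w₀ true) ⟩
  cutAt G P v + 1
    ≡⟨ +-comm _ 1 ⟩
  suc (cutAt G P v)
    ∎
  where
  open ≤-Reasoning
  P : VSet n
  P = pin s t X
  -- Of s and t, only w₀ (the one pinned to the side of v) can count for X but not for P.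
  w₀ : Fin n
  w₀ = if X v then s else t
  pointwise : ∀ u → ⟦ adj G v u ∧ (X u xor X v) ⟧ ≤ ⟦ adj G v u ∧ (P u xor P v) ⟧ + ⟦ ⌊ u ≟ w₀ ⌋ ∧ true ⟧
  pointwise u rewrite pin-other X v≢s v≢t with u ≟ s | u ≟ t
  ... | yes refl | _ with X v
  ...   | true  rewrite ⌊≟⌋-refl u = ≤-trans (⟦⟧≤1 _) (m≤n+m 1 _)
  ...   | false = ≤-trans (⟦∧⟧≤⟦∧true⟧ (adj G v u) _) (m≤m+n _ _)
  pointwise u | no _ | yes refl with X v
  ...   | true  = ≤-trans (⟦∧⟧≤⟦∧true⟧ (adj G v u) _) (m≤m+n _ _)
  ...   | false rewrite ⌊≟⌋-refl u = ≤-trans (⟦⟧≤1 _) (m≤n+m 1 _)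
  pointwise u | no _ | no _ = m≤m+n _ _

-- A friendly minimum cut

6c+d≤6d : ∀ {c d} → d ≢ 1 → c + c ≤ suc d → 6 * c + 1 * d ≤ 6 * d
6c+d≤6d {zero}        {zero}        _   _    = z≤n
6c+d≤6d {suc zero}    {zero}        _   (s≤s ())
6c+d≤6d {suc (suc c)} {zero}        _   (s≤s ())
6c+d≤6d {c}           {suc zero}    d≢1 _    = contradiction refl d≢1
6c+d≤6d {c}           {suc (suc k)} _   c+c≤ = begin
  6 * c + 1 * (2 + k)      ≡⟨ regroup c k ⟩
  3 * (c + c) + (2 + k)    ≤⟨ +-monoˡ-≤ (2 + k) (*-monoʳ-≤ 3 c+c≤) ⟩
  3 * (3 + k) + (2 + k)    ≡⟨ expand k ⟩
  11 + 4 * k               ≤⟨ +-mono-≤ (n≤1+n 11) (*-monoˡ-≤ k (m≤m+n 4 2)) ⟩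
  12 + 6 * k               ≡⟨ expand6 k ⟨
  6 * (2 + k)              ∎
  where
  open ≤-Reasoning
  regroup : ∀ c k → 6 * c + 1 * (2 + k) ≡ 3 * (c + c) + (2 + k)
  regroup = solve-∀
  expand : ∀ k → 3 * (3 + k) + (2 + k) ≡ 11 + 4 * k
  expand = solve-∀
  expand6 : ∀ k → 6 * (2 + k) ≡ 12 + 6 * k
  expand6 = solve-∀

module FriendlyMinCut {n} (G : Graph n) {s t : Fin n} (s≢t : s ≢ t) where

  pinnedCut : VSet n → ℕ
  pinnedCut X = cut G (pin s t X)

  pinnedCut-ext : Extensional pinnedCut
  pinnedCut-ext X≗Y = cut-cong G (pin-cong (λ u _ _ → X≗Y u))

  minCut : ℕ
  minCut = pinnedCut (argmin pinnedCut)

  minCut≤ : ∀ {T} → T s ≡ true → T t ≡ false → minCut ≤ cut G T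
  minCut≤ {T} Ts Tt = ≤-trans (argmin-minimal pinnedCut pinnedCut-ext T) (≤-reflexive (cut-cong G (pin-fixes-stCut Ts Tt)))

  minCut≤n : minCut ≤ n
  minCut≤n = begin
    minCut                                   ≤⟨ minCut≤ {toggle ∅ s} (toggle-at ∅ s) (toggle-other ∅ (≢-sym s≢t)) ⟩
    cut G (toggle ∅ s)                       ≤⟨ cut∘toggle≤cut+deg G ⟩
    cut G ∅ + deg G s                        ≡⟨ cong (_+ deg G s) (cut-∅ G) ⟩
    deg G s                                  ≤⟨ count≤n (adj G s) ⟩
    n                                        ∎
    where open ≤-Reasoning

  private
    candidate : Σ[ S ∈ VSet n ] (pinnedCut S ≤ minCut × (∀ Y → pinnedCut Y ≤ minCut → cut G S ≤ cut G Y))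
    candidate = argmin-within (cut G) pinnedCut (cut-cong G) pinnedCut-ext (argmin pinnedCut) ≤-refl

  S : VSet n
  S = proj₁ candidate

  pinnedCut-S≤minCut : pinnedCut S ≤ minCut
  pinnedCut-S≤minCut = proj₁ (proj₂ candidate)

  S-minimal : ∀ Y → pinnedCut Y ≤ minCut → cut G S ≤ cut G Y
  S-minimal = proj₂ (proj₂ candidate)

  pin-S-isMinCut : IsMinCut G s t (pin s t S)
  pin-S-isMinCut = pin-s {s = s} {t} S , pin-t s≢t S , λ T Ts Tt → ≤-trans pinnedCut-S≤minCut (minCut≤ Ts Tt)

  cut-S≤2n : cut G S ≤ 2 * n
  cut-S≤2n = begin
    cut G S                ≤⟨ S-minimal (pin s t S) (≤-trans (≤-reflexive (cut-cong G (pin-idem S))) pinnedCut-S≤minCut) ⟩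
    cut G (pin s t S)      ≤⟨ pinnedCut-S≤minCut ⟩
    minCut                 ≤⟨ minCut≤n ⟩
    n                      ≤⟨ m≤m+n n (n + 0) ⟩
    2 * n                  ∎
    where open ≤-Reasoning

  private
    toggle-within⇒cutAt+cutAt≤deg : ∀ {v} → pinnedCut (toggle S v) ≤ minCut → cutAt G S v + cutAt G S v ≤ deg G v
    toggle-within⇒cutAt+cutAt≤deg {v} within = cut≤cut∘toggle⇒cutAt+cutAt≤deg G (S-minimal (toggle S v) within)

    toggle-pinned-within : ∀ {v} → v ≡ s ⊎ v ≡ t → pinnedCut (toggle S v) ≤ minCut
    toggle-pinned-within v∈st = ≤-trans (≤-reflexive (cut-cong G (pin∘toggle-pinned S v∈st))) pinnedCut-S≤minCut

  cutAt-S-bound : ∀ v → cutAt G S v + cutAt G S v ≤ suc (deg G v)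
  cutAt-S-bound v with v ≟ s | v ≟ t
  ... | yes v≡s | _       = m≤n⇒m≤1+n (toggle-within⇒cutAt+cutAt≤deg (toggle-pinned-within (inj₁ v≡s)))
  ... | no _    | yes v≡t = m≤n⇒m≤1+n (toggle-within⇒cutAt+cutAt≤deg (toggle-pinned-within (inj₂ v≡t)))
  ... | no v≢s  | no v≢t with cut G (toggle (pin s t S) v) ≤? minCut
  ...   | yes toggled≤ = m≤n⇒m≤1+n (toggle-within⇒cutAt+cutAt≤deg
                                      (≤-trans (≤-reflexive (cut-cong G (pin∘toggle S v≢s v≢t))) toggled≤))
  ...   | no  toggled≰ = begin
    cutAt G S v + cutAt G S v      ≤⟨ +-mono-≤ c≤ c≤ ⟩
    suc c₀ + suc c₀                ≡⟨ cong suc (+-suc c₀ c₀) ⟩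
    suc (suc (c₀ + c₀))            ≤⟨ s≤s 2c₀<d ⟩
    suc (deg G v)                  ∎
    where
    open ≤-Reasoning
    c₀ : ℕ
    c₀ = cutAt G (pin s t S) v
    c≤ : cutAt G S v ≤ suc c₀
    c≤ = cutAt≤suc-cutAt∘pin G S v≢s v≢t
    2c₀<d : c₀ + c₀ < deg G v
    2c₀<d = cut<cut∘toggle⇒cutAt+cutAt<deg G (≤-<-trans pinnedCut-S≤minCut (≰⇒> toggled≰))

  S-friendly : NoDegreeOne G → Friendly G 1 6 S
  S-friendly noDeg1 v = 6c+d≤6d {cutAt G S v} (noDeg1 v) (cutAt-S-bound v)

-- Reading cuts off the sparsifier

IsMinCut-cong : ∀ {n} (G : Graph n) {s t} {X Y : VSet n} → X ≗ Y → IsMinCut G s t X → IsMinCut G s t Y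
IsMinCut-cong G {s} {t} X≗Y (Xs , Xt , X-min) =
  trans (sym (X≗Y s)) Xs , trans (sym (X≗Y t)) Xt , λ T Ts Tt → subst (_≤ cut G T) (cut-cong G X≗Y) (X-min T Ts Tt)

labelledCut : ∀ {n} → (Fin n → Fin n) → Fin n → Fin n → (Fin n → Bool) → VSet n
labelledCut p s t L = pin s t (L ∘ p)

partLabel : ∀ {n} → (Fin n → Fin n) → VSet n → Fin n → Bool
partLabel p S k = ⌊ any? (λ w → p w ≟ k ×-dec T? (S w)) ⌋

partLabel-correct : ∀ {n} {p : Fin n → Fin n} {S} → NotSplit p S → ∀ u → partLabel p S (p u) ≡ S u
partLabel-correct {p = p} {S} notSplit u with any? (λ w → p w ≟ p u ×-dec T? (S w))
... | yes (w , pw≡pu , Sw) = trans (sym (Equivalence.to T-≡ Sw)) (notSplit w u pw≡pu)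
... | no ∄w with S u in Su
...   | true  = contradiction (u , refl , Equivalence.from T-≡ Su) ∄w
...   | false = refl

pin≗labelledCut∘partLabel : ∀ {n} {p : Fin n → Fin n} {s t} {S} → NotSplit p S →
                            pin s t S ≗ labelledCut p s t (partLabel p S)
pin≗labelledCut∘partLabel notSplit = pin-cong (λ u _ _ → sym (partLabel-correct notSplit u))

-- An edge inside a super-vertex crosses labelledCut p s t L only if it is incident to s while L
-- puts the part of s outside, or to t while L puts the part of t inside; d x ∸ count (E x)
-- counts the edges of x inside its super-vertex.
sparsifierCut : ∀ {n} → (Fin n → Fin n) → (Fin n → Fin n → Bool) → (Fin n → ℕ) →
                Fin n → Fin n → (Fin n → Bool) → ℕ
sparsifierCut {n} p E d s t L =
  ∑[ u < n ] ∑[ w < n ] ⟦ S u ∧ not (S w) ∧ E u w ⟧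
    + ((if not (L (p s)) then innerDeg s else 0) + (if L (p t) then innerDeg t else 0))
  where
  S : VSet n
  S = labelledCut p s t L
  innerDeg : Fin n → ℕ
  innerDeg x = d x ∸ count (E x)

module PartwiseCut {n} (G : Graph n) (p : Fin n → Fin n) {s t : Fin n} (L : Fin n → Bool) (S : VSet n)
                     (S-s : S s ≡ true) (S-t : S t ≡ false) (S-other : ∀ {u} → u ≢ s → u ≢ t → S u ≡ L (p u)) where

  inner : Fin n → Fin n → Bool
  inner u w = adj G u w ∧ ⌊ p u ≟ p w ⌋

  private
    inner-sym : ∀ u w → inner u w ≡ inner w u
    inner-sym u w = cong₂ _∧_ (adj-sym G u w) (⌊≟⌋-sym (p u) (p w))

    inner⇒≢ : ∀ {u w} → inner u w ≡ true → u ≢ w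
    inner⇒≢ {u} i refl with adj G u u | loopless G u
    inner⇒≢ {u} () refl | false | refl

    inner⇒L≡ : ∀ {u w} → inner u w ≡ true → L (p u) ≡ L (p w)
    inner⇒L≡ {u} {w} i with p u ≟ p w | adj G u w
    inner⇒L≡ {u} {w} i  | yes pu≡pw | true = cong L pu≡pw
    inner⇒L≡ {u} {w} () | no _      | true

  inner-crossing : ∀ u w →
    ⟦ S u ∧ not (S w) ∧ inner u w ⟧
    ≡ ⟦ ⌊ u ≟ s ⌋ ∧ (not (L (p s)) ∧ inner s w) ⟧ + ⟦ ⌊ w ≟ t ⌋ ∧ (L (p t) ∧ inner t u) ⟧
  inner-crossing u w with u ≟ s | w ≟ t
  ... | yes refl | yes refl rewrite S-s | S-t | inner-sym w u =
    ⟦⟧-partition (inner u w) inner⇒L≡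
  ... | yes refl | no w≢t rewrite S-s =
    trans (⟦∧⟧-cong-guarded (inner u w) (λ i → cong not (trans (S-other (≢-sym (inner⇒≢ i)) w≢t) (sym (inner⇒L≡ i)))))
          (sym (+-identityʳ _))
  ... | no u≢s | yes refl rewrite S-t | inner-sym w u =
    ⟦∧⟧-cong-guarded (inner u w) (λ i → trans (S-other u≢s (inner⇒≢ i)) (inner⇒L≡ i))
  ... | no u≢s | no w≢t = ⟦∧not∧⟧≡0 (inner u w) S-closed
    where
    S-closed : inner u w ≡ true → S u ≡ true → S w ≡ true
    S-closed i Su with w ≟ s
    ... | yes refl = S-s
    ... | no w≢s = trans (S-other w≢s w≢t) (trans (sym (inner⇒L≡ i)) (trans (sym (S-other u≢s u≢t)) Su))
      where
      u≢t : u ≢ t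
      u≢t refl with trans (sym Su) S-t
      ... | ()

  deg∸contracted≡∑inner : ∀ x → deg G x ∸ count (contractEdges G p x) ≡ ∑[ w < n ] ⟦ inner x w ⟧
  deg∸contracted≡∑inner x = begin
    deg G x ∸ count (contractEdges G p x)
      ≡⟨ cong (_∸ count (contractEdges G p x)) (trans (count≡∑ (adj G x)) (∑-split (adj G x) (λ w → ⌊ p x ≟ p w ⌋))) ⟩
    ∑[ w < n ] ⟦ contractEdges G p x w ⟧ + ∑[ w < n ] ⟦ inner x w ⟧ ∸ count (contractEdges G p x)
      ≡⟨ cong (λ m → m + ∑[ w < n ] ⟦ inner x w ⟧ ∸ count (contractEdges G p x)) (count≡∑ (contractEdges G p x)) ⟨
    count (contractEdges G p x) + ∑[ w < n ] ⟦ inner x w ⟧ ∸ count (contractEdges G p x)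
      ≡⟨ m+n∸m≡n (count (contractEdges G p x)) _ ⟩
    ∑[ w < n ] ⟦ inner x w ⟧
      ∎
    where open ≡-Reasoning

  ∑∑-inner-crossing :
    ∑[ u < n ] ∑[ w < n ] ⟦ S u ∧ not (S w) ∧ inner u w ⟧
    ≡ (if not (L (p s)) then deg G s ∸ count (contractEdges G p s) else 0)
      + (if L (p t) then deg G t ∸ count (contractEdges G p t) else 0)
  ∑∑-inner-crossing = begin
    ∑[ u < n ] ∑[ w < n ] ⟦ S u ∧ not (S w) ∧ inner u w ⟧
      ≡⟨ sum-cong-≗ (λ u → sum-cong-≗ (inner-crossing u)) ⟩
    ∑[ u < n ] ∑[ w < n ] (⟦ ⌊ u ≟ s ⌋ ∧ (not (L (p s)) ∧ inner s w) ⟧ + ⟦ ⌊ w ≟ t ⌋ ∧ (L (p t) ∧ inner t u) ⟧)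
      ≡⟨ ∑∑-distrib-+ {n} _ _ ⟩
    ∑[ u < n ] ∑[ w < n ] ⟦ ⌊ u ≟ s ⌋ ∧ (not (L (p s)) ∧ inner s w) ⟧
      + ∑[ u < n ] ∑[ w < n ] ⟦ ⌊ w ≟ t ⌋ ∧ (L (p t) ∧ inner t u) ⟧
      ≡⟨ cong₂ _+_ (∑∑-row {n} s _) (∑∑-column {n} t _) ⟩
    ∑[ w < n ] ⟦ not (L (p s)) ∧ inner s w ⟧ + ∑[ u < n ] ⟦ L (p t) ∧ inner t u ⟧
      ≡⟨ cong₂ _+_ (∑-guard (not (L (p s))) (inner s)) (∑-guard (L (p t)) (inner t)) ⟩
    (if not (L (p s)) then ∑[ w < n ] ⟦ inner s w ⟧ else 0) + (if L (p t) then ∑[ u < n ] ⟦ inner t u ⟧ else 0)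
      ≡⟨ cong₂ _+_ (cong (λ m → if not (L (p s)) then m else 0) (deg∸contracted≡∑inner s))
                   (cong (λ m → if L (p t) then m else 0) (deg∸contracted≡∑inner t)) ⟨
    (if not (L (p s)) then deg G s ∸ count (contractEdges G p s) else 0)
      + (if L (p t) then deg G t ∸ count (contractEdges G p t) else 0)
      ∎
    where open ≡-Reasoning

  cut≡contracted+inner : cut G S ≡
    ∑[ u < n ] ∑[ w < n ] ⟦ S u ∧ not (S w) ∧ contractEdges G p u w ⟧
      + ((if not (L (p s)) then deg G s ∸ count (contractEdges G p s) else 0)
         + (if L (p t) then deg G t ∸ count (contractEdges G p t) else 0))
  cut≡contracted+inner = begin
    cut G S
      ≡⟨ cut≡∑∑ G S ⟩
    ∑[ u < n ] ∑[ w < n ] ⟦ S u ∧ not (S w) ∧ adj G u w ⟧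
      ≡⟨ sum-cong-≗ (λ u → sum-cong-≗ (λ w → ⟦∧∧⟧-split (S u) (not (S w)) (adj G u w) ⌊ p u ≟ p w ⌋)) ⟩
    ∑[ u < n ] ∑[ w < n ] (⟦ S u ∧ not (S w) ∧ contractEdges G p u w ⟧ + ⟦ S u ∧ not (S w) ∧ inner u w ⟧)
      ≡⟨ ∑∑-distrib-+ {n} _ _ ⟩
    ∑[ u < n ] ∑[ w < n ] ⟦ S u ∧ not (S w) ∧ contractEdges G p u w ⟧
      + ∑[ u < n ] ∑[ w < n ] ⟦ S u ∧ not (S w) ∧ inner u w ⟧
      ≡⟨ cong (∑[ u < n ] ∑[ w < n ] ⟦ S u ∧ not (S w) ∧ contractEdges G p u w ⟧ +_) ∑∑-inner-crossing ⟩
    ∑[ u < n ] ∑[ w < n ] ⟦ S u ∧ not (S w) ∧ contractEdges G p u w ⟧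
      + ((if not (L (p s)) then deg G s ∸ count (contractEdges G p s) else 0)
         + (if L (p t) then deg G t ∸ count (contractEdges G p t) else 0))
      ∎
    where open ≡-Reasoning

sparsifierCut-correct : ∀ {n} (G : Graph n) (p : Fin n → Fin n) {s t} → s ≢ t → ∀ L →
                        sparsifierCut p (contractEdges G p) (deg G) s t L ≡ cut G (labelledCut p s t L)
sparsifierCut-correct G p {s} {t} s≢t L =
  sym (PartwiseCut.cut≡contracted+inner G p L (labelledCut p s t L) (pin-s {s = s} {t} (L ∘ p)) (pin-t s≢t (L ∘ p)) (pin-other (L ∘ p)))

decode : Decoder
decode n p E d s t = labelledCut p s t L , sparsifierCut p E d s t L
  where
  L : Fin n → Bool
  L = argmin (sparsifierCut p E d s t)

decode-correct : ∀ {n} (G : Graph n) (p : Fin n → Fin n) {s t} → s ≢ t →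
                 ∀ L₀ → IsMinCut G s t (labelledCut p s t L₀) →
                 let (S , value) = decode n p (contractEdges G p) (deg G) s t
                 in IsMinCut G s t S × value ≡ cut G S
decode-correct {n} G p {s} {t} s≢t L₀ (_ , _ , L₀-min) =
  (pin-s {s = s} {t} (L ∘ p) , pin-t s≢t (L ∘ p) , L-min) , sparsifierCut-correct G p s≢t L
  where
  value : (Fin n → Bool) → ℕ
  value = sparsifierCut p (contractEdges G p) (deg G) s t
  L : Fin n → Bool
  L = argmin value
  value-ext : Extensional value
  value-ext {L₁} {L₂} L₁≗L₂ = begin
    value L₁                       ≡⟨ sparsifierCut-correct G p s≢t L₁ ⟩
    cut G (labelledCut p s t L₁)   ≡⟨ cut-cong G (pin-cong (λ u _ _ → L₁≗L₂ (p u))) ⟩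
    cut G (labelledCut p s t L₂)   ≡⟨ sparsifierCut-correct G p s≢t L₂ ⟨
    value L₂                       ∎
    where open ≡-Reasoning
  L-min : ∀ T → T s ≡ true → T t ≡ false → cut G (labelledCut p s t L) ≤ cut G T
  L-min T Ts Tt = begin
    cut G (labelledCut p s t L)    ≡⟨ sparsifierCut-correct G p s≢t L ⟨
    value L                        ≤⟨ argmin-minimal value value-ext L₀ ⟩
    value L₀                       ≡⟨ sparsifierCut-correct G p s≢t L₀ ⟩
    cut G (labelledCut p s t L₀)   ≤⟨ L₀-min T Ts Tt ⟩
    cut G T                        ∎
    where open ≤-Reasoning

theorem2p1 : Σ Decoder λ dec →
    ∀ (n : ℕ) (G : Graph n) → NoDegreeOne G →
    ∀ (p : Fin n → Fin n) → IsFriendlySparsifier G 1 6 (2 * n) p →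
    ∀ (s t : Fin n) → s ≢ t →
      IsMinCut G s t (proj₁ (dec n p (contractEdges G p) (deg G) s t))
      × proj₂ (dec n p (contractEdges G p) (deg G) s t)
          ≡ cut G (proj₁ (dec n p (contractEdges G p) (deg G) s t))
theorem2p1 = decode , λ n G noDeg1 p sparsifier s t s≢t →
  let open FriendlyMinCut G s≢t
  in decode-correct G p s≢t (partLabel p S)
       (IsMinCut-cong G (pin≗labelledCut∘partLabel (sparsifier S (S-friendly noDeg1) cut-S≤2n)) pin-S-isMinCut)
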